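{- Let $n$ be a positive integer. There exist positive integers $a,b$ such that $(n,n,a,b)$ is a rectangular donut if and only if $n = x+y+z$ for some Pythagorean triple $(x,y,z)$, i.e. positive integers $x,y,z$ with $x^2+y^2=z^2$.
   Context: All numbers are positive integers. A rectangular donut is an ordered quadruple $(A,B,X,Y)$ of positive integers such that $1 < B \le A < AB$, $AB = 2XY$, $1 \le X < A$ and $1 \le Y < B$. (Geometrically: an $A\times B$ rectangle containing an $X \times Y$ rectangle with parallel sides, the larger rectangle having twice the area of the smaller.) Thus $(n,n,a,b)$ is a donut (a square donut of side length $n$) exactly when $n>1$, $n^2 = 2ab$, $1\le a<n$ and $1\le b<n$. Pythagorean triples need not be primitive. -}

module Defs where

open import Data.Nat using (ℕ; _+_; _*_; _<_; _≤_)
open import Data.Product using (_×_)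
open import Relation.Binary.PropositionalEquality using (_≡_)

RectangularDonut : ℕ → ℕ → ℕ → ℕ → Set
RectangularDonut A B X Y =
  (1 < B) × (B ≤ A) × (A < A * B) × (A * B ≡ 2 * (X * Y))
  × (1 ≤ X) × (X < A) × (1 ≤ Y) × (Y < B)

PythagoreanTriple : ℕ → ℕ → ℕ → Set
PythagoreanTriple x y z =
  (1 ≤ x) × (1 ≤ y) × (1 ≤ z) × (x * x + y * y ≡ z * z)

-- For a = y + z, b = x + z and n = x + y + z one has n² + z² = 2ab + (x² + y²),
-- so n² = 2ab iff x² + y² = z². Conversely every square donut (n, n, a, b) has
-- a, b < n < a + b, hence is of that shape with x = n - a, y = n - b, z = a + b - n.

module Submission where

open import Defs
open import Data.Nat using (ℕ; _+_; _*_; _∸_; _≤_; _<_; z<s; >-nonZero)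
open import Data.Nat.Properties
open import Data.Nat.Tactic.RingSolver using (solve-∀; solve)
open import Data.List.Base using (_∷_; [])
open import Data.Product using (Σ; _×_; _,_)
open import Function.Bundles using (_⇔_; mk⇔; Equivalence)
open import Relation.Binary.PropositionalEquality

perimeter-square-identity : ∀ x y z →
  (x + y + z) * (x + y + z) + z * z ≡ 2 * ((y + z) * (x + z)) + (x * x + y * y)
perimeter-square-identity = solve-∀

pythagorean⇔perimeter-square : ∀ x y z →
  (x * x + y * y ≡ z * z) ⇔ ((x + y + z) * (x + y + z) ≡ 2 * ((y + z) * (x + z)))
pythagorean⇔perimeter-square x y z = mk⇔ ⇒ ⇐
  where
  n = x + y + z
  ⇒ : x * x + y * y ≡ z * z → n * n ≡ 2 * ((y + z) * (x + z))
  ⇒ pyth = +-cancelʳ-≡ (z * z) (n * n) (2 * ((y + z) * (x + z)))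
    (trans (perimeter-square-identity x y z) (cong (2 * ((y + z) * (x + z)) +_) pyth))
  ⇐ : n * n ≡ 2 * ((y + z) * (x + z)) → x * x + y * y ≡ z * z
  ⇐ area = +-cancelˡ-≡ (2 * ((y + z) * (x + z))) (x * x + y * y) (z * z)
    (trans (sym (perimeter-square-identity x y z)) (cong (_+ z * z) area))

m*m<n*n⇒m<n : ∀ {m n} → m * m < n * n → m < n
m*m<n*n⇒m<n m*m<n*n = ≰⇒> (λ n≤m → <⇒≱ m*m<n*n (*-mono-≤ n≤m n≤m))

square≡twice-product⇒<sum : ∀ {n a b} → 1 ≤ a → n * n ≡ 2 * (a * b) → n < a + b
square≡twice-product⇒<sum {n} {a} {b} 1≤a area = m*m<n*n⇒m<n (begin-strict
  n * n                          ≡⟨ area ⟩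
  2 * (a * b)                    <⟨ m<m+n (2 * (a * b)) (≤-trans (*-mono-≤ 1≤a 1≤a) (m≤m+n (a * a) (b * b))) ⟩
  2 * (a * b) + (a * a + b * b)  ≡⟨ solve (a ∷ b ∷ []) ⟩
  (a + b) * (a + b)              ∎)
  where open ≤-Reasoning

triangle-decomposition : ∀ {n a b} → a < n → b < n → n < a + b →
  Σ ℕ λ x → Σ ℕ λ y → Σ ℕ λ z →
    (1 ≤ x) × (1 ≤ y) × (1 ≤ z) × (a ≡ y + z) × (b ≡ x + z) × (n ≡ x + y + z)
triangle-decomposition {n} {a} {b} a<n b<n n<a+b =
  x , y , z , m<n⇒0<n∸m a<n , m<n⇒0<n∸m b<n , m<n⇒0<n∸m n<a+b , a≡y+z , b≡x+z , n≡x+y+z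
  where
  x = n ∸ a
  y = n ∸ b
  z = a + b ∸ n
  a+x≡n : a + x ≡ n
  a+x≡n = m+[n∸m]≡n (<⇒≤ a<n)
  b+y≡n : b + y ≡ n
  b+y≡n = m+[n∸m]≡n (<⇒≤ b<n)
  n+z≡a+b : n + z ≡ a + b
  n+z≡a+b = m+[n∸m]≡n (<⇒≤ n<a+b)
  b≡x+z : b ≡ x + z
  b≡x+z = +-cancelˡ-≡ a b (x + z) (begin
    a + b        ≡⟨ sym n+z≡a+b ⟩
    n + z        ≡⟨ cong (_+ z) (sym a+x≡n) ⟩
    a + x + z    ≡⟨ +-assoc a x z ⟩
    a + (x + z)  ∎)
    where open ≡-Reasoning
  a≡y+z : a ≡ y + z
  a≡y+z = +-cancelˡ-≡ b a (y + z) (begin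
    b + a        ≡⟨ +-comm b a ⟩
    a + b        ≡⟨ sym n+z≡a+b ⟩
    n + z        ≡⟨ cong (_+ z) (sym b+y≡n) ⟩
    b + y + z    ≡⟨ +-assoc b y z ⟩
    b + (y + z)  ∎)
    where open ≡-Reasoning
  n≡x+y+z : n ≡ x + y + z
  n≡x+y+z = begin
    n            ≡⟨ sym a+x≡n ⟩
    a + x        ≡⟨ cong (_+ x) a≡y+z ⟩
    y + z + x    ≡⟨ +-comm (y + z) x ⟩
    x + (y + z)  ≡⟨ +-assoc x y z ⟨
    x + y + z    ∎
    where open ≡-Reasoning

SquareDonut : ℕ → Set
SquareDonut n = Σ ℕ λ a → Σ ℕ λ b → (1 ≤ a) × (1 ≤ b) × RectangularDonut n n a b

PythagoreanPerimeter : ℕ → Set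
PythagoreanPerimeter n = Σ ℕ λ x → Σ ℕ λ y → Σ ℕ λ z → PythagoreanTriple x y z × (n ≡ x + y + z)

squareDonut⇒pythagoreanPerimeter : ∀ {n} → SquareDonut n → PythagoreanPerimeter n
squareDonut⇒pythagoreanPerimeter (a , b , 1≤a , _ , (_ , _ , _ , area , _ , a<n , _ , b<n))
  with triangle-decomposition a<n b<n (square≡twice-product⇒<sum 1≤a area)
... | x , y , z , 1≤x , 1≤y , 1≤z , refl , refl , refl =
  x , y , z , (1≤x , 1≤y , 1≤z , Equivalence.from (pythagorean⇔perimeter-square x y z) area) , refl

pythagoreanPerimeter⇒squareDonut : ∀ {n} → PythagoreanPerimeter n → SquareDonut n
pythagoreanPerimeter⇒squareDonut (x , y , z , (1≤x , 1≤y , 1≤z , pyth) , refl) =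
  y + z , x + z , 1≤y+z , 1≤x+z ,
  (1<n , ≤-refl , n<n*n , area , 1≤y+z , y+z<n , 1≤x+z , x+z<n)
  where
  n = x + y + z
  1≤y+z : 1 ≤ y + z
  1≤y+z = ≤-trans 1≤y (m≤m+n y z)
  1≤x+z : 1 ≤ x + z
  1≤x+z = ≤-trans 1≤x (m≤m+n x z)
  y+z<n : y + z < n
  y+z<n = subst (y + z <_) (sym (+-assoc x y z)) (m<n+m (y + z) 1≤x)
  x+z<n : x + z < n
  x+z<n = subst (x + z <_) (sym (+-assoc x y z)) (+-monoʳ-< x (m<n+m z 1≤y))
  1<n : 1 < n
  1<n = ≤-<-trans 1≤y+z y+z<n
  n<n*n : n < n * n
  n<n*n = m<m*n n n {{>-nonZero (<-trans z<s 1<n)}} 1<n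
  area : n * n ≡ 2 * ((y + z) * (x + z))
  area = Equivalence.to (pythagorean⇔perimeter-square x y z) pyth

theorem4 : (n : ℕ) → 1 ≤ n →
    (Σ ℕ (λ a → Σ ℕ (λ b → (1 ≤ a) × (1 ≤ b) × RectangularDonut n n a b)))
    ⇔ (Σ ℕ (λ x → Σ ℕ (λ y → Σ ℕ (λ z → PythagoreanTriple x y z × (n ≡ x + y + z)))))
theorem4 n _ = mk⇔ squareDonut⇒pythagoreanPerimeter pythagoreanPerimeter⇒squareDonut
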